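{- For all (not necessarily typed) terms $t,s$: $\pi(ts)\preccurlyeq\pi(t)+\pi(s)$.
   Context: Raw terms are $r,s,t ::= x \mid c \mid \lambda x.t \mid \langle t,s\rangle \mid t s \mid \{t\}$ over typed variables and the constants $\mathsf{tt},\mathsf{ff}$ (type $\mathbf B$), $\mathsf{nil}_\tau$ (type $\mathbf L(\tau)$), $\mathsf{cons}_\tau$ (type $\Diamond\multimap\tau\multimap\mathbf L(\tau)\multimap\mathbf L(\tau)$) and $\otimes_{\tau,\rho}$ (type $\tau\multimap\rho\multimap\tau\otimes\rho$). A list with $n$ entries is a term $\mathsf{cons}_\tau d_1 a_1(\cdots(\mathsf{cons}_\tau d_n a_n\,\mathsf{nil}_\tau))$ where the $d_i$ are terms typable with type $\Diamond$ and the $a_i$ terms typable with type $\tau$ (in the linear typing system of the paper). Length: $|c|=|x|=1$, $|ts|=|t|+|s|$, $|\lambda x.s|=|s|+1$, $|\langle t,s\rangle|=\max(|t|,|s|)+1$, $|\{t\}|=0$. Let $\mathbb N^{\mathrm{poly}}$ be the set of functions $\mathbb N\to\mathbb N$ bounded pointwise by a polynomial, with pointwise sum, product, maximum $\sup$ and order $\preccurlyeq$; naturals are constant functions, $X$ is the identity, and $X_n(m)=\min(n,m)$. The polynomial bound $\pi(t)\in\mathbb N^{\mathrm{poly}}$ is defined by recursion on terms: $\pi(x)=\pi(c)=0$; $\pi(ts)=\pi(t)+X_n\cdot\pi(h)+X_n\cdot|h|$ if $t$ is a list with $n$ entries and $s=\{h\}$, and $\pi(ts)=\pi(t)+\pi(s)$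 otherwise; $\pi(\lambda x.t)=\pi(t)$; $\pi(\langle t,s\rangle)=\sup(\pi(t),\pi(s))$; $\pi(\{h\})=X\cdot\pi(h)+X\cdot|h|$. -}

module Defs where

open import Data.Nat using (ℕ; zero; suc; _+_; _*_; _⊔_; _⊓_; _≤_)
open import Data.Bool using (Bool; true; false; _∧_; if_then_else_)
open import Data.Maybe using (Maybe; just; nothing)

-- Types of the linear system (only the formers named in the context are
-- needed; extra formers of the paper do not affect the statement).
data Ty : Set where
  𝐁   : Ty
  𝐋   : Ty → Ty
  ◇   : Ty
  _⊸_ : Ty → Ty → Ty
  _⊗_ : Ty → Ty → Ty
  _×ᵗ_ : Ty → Ty → Ty
  !_  : Ty → Ty

data Const : Set where
  ttC ffC : Const
  nilC    : Ty → Const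
  consC   : Ty → Const
  tensorC : Ty → Ty → Const

data Term : Set where
  var   : ℕ → Ty → Term
  con   : Const → Term
  lam   : ℕ → Ty → Term → Term
  pair  : Term → Term → Term
  app   : Term → Term → Term
  brace : Term → Term

∣_∣ : Term → ℕ
∣ var _ _ ∣  = 1
∣ con _ ∣    = 1
∣ lam _ _ s ∣ = ∣ s ∣ + 1
∣ pair t s ∣ = (∣ t ∣ ⊔ ∣ s ∣) + 1
∣ app t s ∣  = ∣ t ∣ + ∣ s ∣
∣ brace _ ∣  = 0

-- Polynomially bounded functions, represented as functions ℕ → ℕ
-- with pointwise operations and order.
Fn : Set
Fn = ℕ → ℕ

_≼_ : Fn → Fn → Set
f ≼ g = ∀ m → f m ≤ g m

_⊕_ : Fn → Fn → Fn
(f ⊕ g) m = f m + g m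

-- Typability in the paper's linear typing system is abstracted as a
-- decision procedure `typable t τ` ("t is typable with type τ").
Typability : Set
Typability = Term → Ty → Bool

_≟ᵗ_ : Ty → Ty → Bool
𝐁 ≟ᵗ 𝐁 = true
𝐋 a ≟ᵗ 𝐋 b = a ≟ᵗ b
◇ ≟ᵗ ◇ = true
(a ⊸ b) ≟ᵗ (c ⊸ d) = (a ≟ᵗ c) ∧ (b ≟ᵗ d)
(a ⊗ b) ≟ᵗ (c ⊗ d) = (a ≟ᵗ c) ∧ (b ≟ᵗ d)
(a ×ᵗ b) ≟ᵗ (c ×ᵗ d) = (a ≟ᵗ c) ∧ (b ≟ᵗ d)
(! a) ≟ᵗ (! b) = a ≟ᵗ b
_ ≟ᵗ _ = false

mapSuc : Maybe ℕ → Maybe ℕ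
mapSuc (just n) = just (suc n)
mapSuc nothing  = nothing

listLenAt : Typability → Ty → Term → Maybe ℕ
listLenAt ty τ (con (nilC σ)) = if τ ≟ᵗ σ then just 0 else nothing
listLenAt ty τ (app (app (app (con (consC σ)) d) a) r) =
  if (τ ≟ᵗ σ) ∧ ty d ◇ ∧ ty a τ then mapSuc (listLenAt ty τ r) else nothing
listLenAt ty τ _ = nothing

listLen : Typability → Term → Maybe ℕ
listLen ty t@(con (nilC τ)) = listLenAt ty τ t
listLen ty t@(app (app (app (con (consC τ)) _) _) _) = listLenAt ty τ t
listLen ty _ = nothing

-- The polynomial bound π(t) (X is the identity, X_n(m) = min(n,m)).
-- π(ts) = π(t) + X_n·π(h) + X_n·|h|  if t is a list with n entries, s = {h};
-- π(ts) = π(t) + π(s) otherwise.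
π : Typability → Term → Fn
π ty (var _ _) m = 0
π ty (con _) m = 0
π ty (lam _ _ t) m = π ty t m
π ty (pair t s) m = π ty t m ⊔ π ty s m
π ty (brace h) m = m * π ty h m + m * ∣ h ∣
π ty (app t (brace h)) m = appBrace (listLen ty t)
  where
  appBrace : Maybe ℕ → ℕ
  appBrace (just n) = π ty t m + (n ⊓ m) * π ty h m + (n ⊓ m) * ∣ h ∣
  appBrace nothing  = π ty t m + (m * π ty h m + m * ∣ h ∣)
π ty (app t s@(var _ _)) m = π ty t m + π ty s m
π ty (app t s@(con _)) m = π ty t m + π ty s m
π ty (app t s@(lam _ _ _)) m = π ty t m + π ty s m
π ty (app t s@(pair _ _)) m = π ty t m + π ty s m
π ty (app t s@(app _ _)) m = π ty t m + π ty s m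

{-# OPTIONS --safe #-}
module Submission where

open import Defs
open import Data.Nat using (ℕ; _+_; _*_; _⊓_; _≤_)
open import Data.Nat.Properties
open import Data.Maybe using (just; nothing)

-- Only for s = {h} with t a list of n entries does π(ts) differ from π(t) + π(s);
-- there the factor X_n = n ⊓ m is dominated by the factor X = m of π({h}).

*-+-monoˡ-≤ : ∀ {a b} (p q : ℕ) → a ≤ b → a * p + a * q ≤ b * p + b * q
*-+-monoˡ-≤ p q a≤b = +-mono-≤ (*-monoˡ-≤ p a≤b) (*-monoˡ-≤ q a≤b)

proposition4p6 : (ty : Typability) (t s : Term) →
    π ty (app t s) ≼ (π ty t ⊕ π ty s)
proposition4p6 ty t (var _ _) m = ≤-refl
proposition4p6 ty t (con _) m = ≤-refl
proposition4p6 ty t (lam _ _ _) m = ≤-refl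
proposition4p6 ty t (pair _ _) m = ≤-refl
proposition4p6 ty t (app _ _) m = ≤-refl
proposition4p6 ty t (brace h) m with listLen ty t
... | nothing = ≤-refl
... | just n = begin
  π ty t m + n ⊓ m * π ty h m + n ⊓ m * ∣ h ∣   ≡⟨ +-assoc (π ty t m) _ _ ⟩
  π ty t m + (n ⊓ m * π ty h m + n ⊓ m * ∣ h ∣) ≤⟨ +-monoʳ-≤ (π ty t m) (*-+-monoˡ-≤ (π ty h m) ∣ h ∣ (m⊓n≤n n m)) ⟩
  π ty t m + (m * π ty h m + m * ∣ h ∣)         ∎
  where open ≤-Reasoning
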